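{- For any graph $G$ and any field $\mathbb{K}$ there exist a finite set $V'$ and abstract simplicial complexes $\Delta'\subset\Delta$ on $V'$ such that for all $k\in\mathbb{Z}_{>0}$ \[ \chi_G(k)=\mathcal{H}_{I_{\Delta/\Delta'}}(k). \]
   Context: A graph is a tuple $(V,E,\mathrm{head},\mathrm{tail})$ with finite vertex set $V$, finite edge set $E$ and maps $\mathrm{head},\mathrm{tail}:E\to V$ (loops and multiple edges allowed); $u\sim v$ means $u,v$ are joined by an edge. A $k$-coloring is a map $x:V\to\{0,\ldots,k-1\}$, proper if $x_u\neq x_v$ whenever $u\sim v$ (so a graph with a loop has no proper colorings). $\chi_G(k)$ is the number of proper $k$-colorings of $G$. For an abstract simplicial complex $\Delta$ on a finite set $V'$, identify $V'$ with the variables of $\mathbb{K}[x]=\mathbb{K}[x_v:v\in V']$ (standard grading). The Stanley–Reisner ideal is $I_\Delta=\langle x^u:\mathrm{supp}(u)\notin\Delta\rangle$, $\mathbb{K}[\Delta]=\mathbb{K}[x]/I_\Delta$, and for a subcomplex $\Delta'\subset\Delta$ the relative Stanley–Reisner ideal $I_{\Delta/\Delta'}$ is the ideal of $\mathbb{K}[\Delta]$ generated by the monomials $x^u$ with $\mathrm{supp}(u)\notin\Delta'$. Its Hilbert function $\mathcal{H}_{I_{\Delta/\Delta'}}(k)$ is the number of monomials $x^u$ of degree $k$ with $\mathrm{supp}(u)\in\Delta\setminus\Delta'$. -}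

module Defs where

open import Data.Nat using (ℕ; zero; suc; _≟_)
open import Data.Fin using (Fin; toℕ)
import Data.Fin as F
open import Data.Fin.Properties using (all?)
open import Data.Fin.Subset using (Subset; _⊆_; inside; outside)
open import Data.Bool using (Bool; true; false; if_then_else_; T)
open import Data.Vec using (Vec; []; _∷_; lookup; tabulate; toList)
open import Data.List using (List; [_]; map; concatMap; filter; length)
open import Data.Nat.ListAction using (sum)
open import Data.Product using (_×_)
open import Relation.Nullary using (¬_; Dec; does; ¬?)
open import Relation.Binary.PropositionalEquality using (_≡_)
import Data.Fin.Properties as FP

-- A (finite multi-)graph (V,E,head,tail) with V = Fin n, E = Fin m.
-- Loops and multiple edges are allowed.
record Graph : Set where
  field
    nV   : ℕ
    nE   : ℕ
    head : Fin nE → Fin nV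
    tail : Fin nE → Fin nV

allVecs : (n k : ℕ) → List (Vec (Fin k) n)
allVecs zero    k = [ [] ]
allVecs (suc n) k = concatMap (λ i → map (i ∷_) (allVecs n k)) (Data.List.allFin k)
  where import Data.List

-- A k-coloring x is proper if x_u ≠ x_v whenever u ~ v, i.e. for every edge e,
-- x (tail e) ≠ x (head e).  (A loop makes this impossible.)
Proper : (G : Graph) {k : ℕ} → Vec (Fin k) (Graph.nV G) → Set
Proper G x = ∀ e → ¬ (lookup x (Graph.tail G e) ≡ lookup x (Graph.head G e))

proper? : (G : Graph) {k : ℕ} (x : Vec (Fin k) (Graph.nV G)) → Dec (Proper G x)
proper? G x = all? (λ e → ¬? (lookup x (Graph.tail G e) FP.≟ lookup x (Graph.head G e)))

chromatic : Graph → ℕ → ℕ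
chromatic G k = length (filter (proper? G) (allVecs (Graph.nV G) k))

record SimplicialComplex (N : ℕ) : Set where
  field
    face   : Subset N → Bool
    closed : ∀ {σ τ : Subset N} → τ ⊆ σ → T (face σ) → T (face τ)
open SimplicialComplex public

_≤SC_ : {N : ℕ} → SimplicialComplex N → SimplicialComplex N → Set
Δ' ≤SC Δ = ∀ σ → T (face Δ' σ) → T (face Δ σ)

-- Exponent vectors u ∈ ℕ^N (with entries ≤ k) and their degree.
degree : {N k : ℕ} → Vec (Fin k) N → ℕ
degree u = sum (map toℕ (toList u))

-- Monomials x^u of degree k in N variables: all u with |u| = k
-- (every entry of such u is automatically ≤ k, so u ∈ Fin (suc k)^N).
monomials : (N k : ℕ) → List (Vec (Fin (suc k)) N)
monomials N k = filter (λ u → degree u ≟ k) (allVecs N (suc k))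

supp : {N k : ℕ} → Vec (Fin k) N → Subset N
supp u = tabulate (λ i → if does (toℕ (lookup u i) ≟ 0) then outside else inside)

inRel : {N : ℕ} → SimplicialComplex N → SimplicialComplex N → Subset N → Bool
inRel Δ Δ' σ = if face Δ σ then (if face Δ' σ then false else true) else false

-- Hilbert function of the relative Stanley–Reisner ideal I_{Δ/Δ'}:
-- number of monomials x^u of degree k with supp(u) ∈ Δ ∖ Δ'.
hilbertRel : {N : ℕ} → SimplicialComplex N → SimplicialComplex N → ℕ → ℕ
hilbertRel {N} Δ Δ' k =
  length (filter (λ u → Data.Bool._≟_ (inRel Δ Δ' (supp u)) true) (monomials N k))
  where import Data.Bool

-- A proper k-colouring is the same as an ordered partition of V into s nonempty independent sets
-- (its colour classes, in increasing colour order) together with the s colours used, so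
-- χ_G(k) = Σ_s a_s C(k,s) with a_s the number of such ordered partitions; this is proved by induction
-- on k, splitting off the class of one colour.
--
-- Let Δ be the disjoint union of simplices on blocks of sizes b₁, …, b_r and Δ' the union of their
-- boundaries.  The faces of Δ ∖ Δ' are the blocks, and a degree-k monomial supported exactly on a block
-- of size b is a composition of k into b positive parts; there are C(k−1,b−1) of them.  Taking a_s
-- blocks of size s and a_s of size s+1 for every s, Pascal's rule C(k−1,s−1) + C(k−1,s) = C(k,s)
-- turns the Hilbert function of I_{Δ/Δ'} into χ_G at every k > 0.

module Submission where

open import Defs
open import Data.Nat.Properties
open import Algebra.Properties.CommutativeSemigroup +-commutativeSemigroup using (x∙yz≈y∙xz)
open import Algebra.Properties.Semiring.Sum +-*-semiring
  using (sum-syntax; sum-cong-≗; sum-replicate-zero; ∑-distrib-+; ∑-comm; *-distribˡ-sum)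
open import Data.Bool as Bool using (Bool; true; false; _∧_; _∨_; not; T; if_then_else_)
open import Data.Bool.Properties using (∧-zeroʳ; ∧-assoc; T-∧; T-∨; T-≡)
open import Data.Fin using (Fin; zero; suc; toℕ)
import Data.Fin.Properties as FP
open import Data.Fin.Subset using (Subset; _⊆_; _∈_; _∪_; ⊥)
open import Data.Fin.Subset.Properties using (drop-∷-⊆; out⊆; in⊆in; ∪-identityʳ)
open import Data.List as List using (List; []; _∷_; filter; length; concatMap)
open import Data.List.Properties using (map-++; map-cong; map-∘)
open import Data.Nat using (ℕ; zero; suc; _+_; _*_; _∸_; _≤_; _<_; z≤n; s≤s; _≡ᵇ_; _≤ᵇ_)
open import Data.Nat.Combinatorics using (_C_; nCk+nC[k+1]≡[n+1]C[k+1])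
open import Data.Nat.Solver using (module +-*-Solver)
open import Data.Nat.ListAction using () renaming (sum to sumˡ)
open import Data.Nat.ListAction.Properties using (sum-++)
open import Data.Product using (Σ; _×_; _,_; proj₁; proj₂)
open import Data.Sum using (inj₁; inj₂)
open import Data.Empty using (⊥-elim)
open import Function.Bundles using (module Equivalence)
open Equivalence using (to; from)
open import Data.Vec as Vec using (Vec; []; _∷_; _++_; lookup; replicate; zipWith; here)
open import Data.Vec.Properties using (lookup-map; lookup-replicate; lookup-zipWith)
open import Function using (id; _∘_)
open import Relation.Nullary using (Dec; does)
open import Relation.Nullary.Decidable using (dec-true; dec-false)
open import Relation.Nullary.Negation using (¬_)
open import Relation.Binary.PropositionalEquality

ind : Bool → ℕ
ind true  = 1
ind false = 0

ind-∧ : ∀ a b → ind (a ∧ b) ≡ ind a * ind b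
ind-∧ true  b = sym (+-identityʳ (ind b))
ind-∧ false b = refl

∑-cong : ∀ n {f g : Fin n → ℕ} → (∀ i → f i ≡ g i) → ∑[ i < n ] f i ≡ ∑[ i < n ] g i
∑-cong n {f} {g} = sum-cong-≗ {x = f} {y = g}

module _ {A : Set} {M : ℕ} (enum : Fin M → A) where

  ∑Vec : ∀ n → (Vec A n → ℕ) → ℕ
  ∑Vec zero    f = f []
  ∑Vec (suc n) f = ∑[ i < M ] ∑Vec n (λ v → f (enum i ∷ v))

  ∑Vec-cong : ∀ n {f g : Vec A n → ℕ} → (∀ v → f v ≡ g v) → ∑Vec n f ≡ ∑Vec n g
  ∑Vec-cong zero    f≗g = f≗g []
  ∑Vec-cong (suc n) f≗g = ∑-cong M (λ i → ∑Vec-cong n (λ v → f≗g (enum i ∷ v)))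

  ∑Vec-distrib-+ : ∀ n (f g : Vec A n → ℕ) → ∑Vec n (λ v → f v + g v) ≡ ∑Vec n f + ∑Vec n g
  ∑Vec-distrib-+ zero    f g = refl
  ∑Vec-distrib-+ (suc n) f g =
    trans (∑-cong M (λ i → ∑Vec-distrib-+ n (λ v → f (enum i ∷ v)) (λ v → g (enum i ∷ v))))
          (∑-distrib-+ (λ i → ∑Vec n (λ v → f (enum i ∷ v))) _)

  ∑Vec-distribˡ : ∀ n c (f : Vec A n → ℕ) → ∑Vec n (λ v → c * f v) ≡ c * ∑Vec n f
  ∑Vec-distribˡ zero    c f = refl
  ∑Vec-distribˡ (suc n) c f = trans (∑-cong M (λ i → ∑Vec-distribˡ n c (λ v → f (enum i ∷ v))))
                                    (sym (*-distribˡ-sum c (λ i → ∑Vec n (λ v → f (enum i ∷ v)))))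

  ∑Vec-distribʳ : ∀ n c (f : Vec A n → ℕ) → ∑Vec n (λ v → f v * c) ≡ ∑Vec n f * c
  ∑Vec-distribʳ n c f =
    trans (∑Vec-cong n (λ v → *-comm (f v) c)) (trans (∑Vec-distribˡ n c f) (*-comm c _))

  ∑Vec-zero : ∀ n → ∑Vec n (λ _ → 0) ≡ 0
  ∑Vec-zero zero    = refl
  ∑Vec-zero (suc n) = trans (∑-cong M (λ _ → ∑Vec-zero n)) (sum-replicate-zero M)

  ∑Vec-++ : ∀ s m (f : Vec A (s + m) → ℕ) →
            ∑Vec (s + m) f ≡ ∑Vec s (λ a → ∑Vec m (λ b → f (a ++ b)))
  ∑Vec-++ zero    m f = refl
  ∑Vec-++ (suc s) m f = ∑-cong M (λ i → ∑Vec-++ s m (λ v → f (enum i ∷ v)))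

  ∑Vec-comm : ∀ n {K} (h : Vec A n → Fin K → ℕ) →
              ∑Vec n (λ v → ∑[ j < K ] h v j) ≡ ∑[ j < K ] ∑Vec n (λ v → h v j)
  ∑Vec-comm zero    h = refl
  ∑Vec-comm (suc n) h = trans (∑-cong M (λ i → ∑Vec-comm n (λ v → h (enum i ∷ v))))
                                (∑-comm (λ i j → ∑Vec n (λ v → h (enum i ∷ v) j)))

∑Col : ∀ n M → (Vec (Fin M) n → ℕ) → ℕ
∑Col n M = ∑Vec id n

bool : Fin 2 → Bool
bool zero    = true
bool (suc _) = false

∑Sub : ∀ n → (Subset n → ℕ) → ℕ
∑Sub = ∑Vec bool

length-filter : ∀ {A : Set} {P : A → Set} (P? : ∀ x → Dec (P x)) xs →
                length (filter P? xs) ≡ sumˡ (List.map (λ x → ind (does (P? x))) xs)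
length-filter P? []       = refl
length-filter P? (x ∷ xs) with does (P? x)
... | true  = cong suc (length-filter P? xs)
... | false = length-filter P? xs

sum-map-filter : ∀ {A : Set} {P : A → Set} (P? : ∀ x → Dec (P x)) (g : A → ℕ) xs →
                 sumˡ (List.map g (filter P? xs)) ≡ sumˡ (List.map (λ x → ind (does (P? x)) * g x) xs)
sum-map-filter P? g []       = refl
sum-map-filter P? g (x ∷ xs) with does (P? x)
... | true  = cong₂ _+_ (sym (+-identityʳ (g x))) (sum-map-filter P? g xs)
... | false = sum-map-filter P? g xs

sum-map-concatMap : ∀ {A B : Set} (f : B → ℕ) (g : A → List B) xs →
                    sumˡ (List.map f (concatMap g xs)) ≡ sumˡ (List.map (λ x → sumˡ (List.map f (g x))) xs)
sum-map-concatMap f g []       = refl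
sum-map-concatMap f g (x ∷ xs) = begin
  sumˡ (List.map f (g x List.++ concatMap g xs))                 ≡⟨ cong sumˡ (map-++ f (g x) _) ⟩
  sumˡ (List.map f (g x) List.++ List.map f (concatMap g xs))    ≡⟨ sum-++ (List.map f (g x)) _ ⟩
  sumˡ (List.map f (g x)) + sumˡ (List.map f (concatMap g xs))   ≡⟨ cong (_ +_) (sum-map-concatMap f g xs) ⟩
  sumˡ (List.map f (g x)) + sumˡ (List.map _ xs)                 ∎
  where open ≡-Reasoning

sum-map-tabulate : ∀ {A : Set} m (h : A → ℕ) (u : Fin m → A) →
                   sumˡ (List.map h (List.tabulate u)) ≡ ∑[ i < m ] h (u i)
sum-map-tabulate zero    h u = refl
sum-map-tabulate (suc m) h u = cong (h (u zero) +_) (sum-map-tabulate m h (u ∘ suc))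

sum-map-allVecs : ∀ n M (f : Vec (Fin M) n → ℕ) → sumˡ (List.map f (allVecs n M)) ≡ ∑Col n M f
sum-map-allVecs zero    M f = +-identityʳ (f [])
sum-map-allVecs (suc n) M f = begin
  sumˡ (List.map f (allVecs (suc n) M))
    ≡⟨ sum-map-concatMap f _ (List.allFin M) ⟩
  sumˡ (List.map (λ i → sumˡ (List.map f (List.map (i ∷_) (allVecs n M)))) (List.allFin M))
    ≡⟨ sum-map-tabulate M _ id ⟩
  ∑[ i < M ] sumˡ (List.map f (List.map (i ∷_) (allVecs n M)))
    ≡⟨ ∑-cong M (λ i → cong sumˡ (map-∘ (allVecs n M))) ⟨
  ∑[ i < M ] sumˡ (List.map (λ v → f (i ∷ v)) (allVecs n M))
    ≡⟨ ∑-cong M (λ i → sum-map-allVecs n M (λ v → f (i ∷ v))) ⟩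
  ∑Col (suc n) M f ∎
  where open ≡-Reasoning

sum-map-replicate : ∀ (g : ℕ → ℕ) r x → sumˡ (List.map g (List.replicate r x)) ≡ r * g x
sum-map-replicate g zero    x = refl
sum-map-replicate g (suc r) x = cong (g x +_) (sum-map-replicate g r x)

sum-map-applyUpTo : ∀ (h : ℕ → ℕ) (f : ℕ → ℕ) D →
                    sumˡ (List.map h (List.applyUpTo f D)) ≡ ∑[ s < D ] h (f (toℕ s))
sum-map-applyUpTo h f zero    = refl
sum-map-applyUpTo h f (suc D) = cong (h (f 0) +_) (sum-map-applyUpTo h (f ∘ suc) D)

-- Compositions and binomial coefficients

-- compositions s d is the number of ways to write d as an ordered sum of s positive parts:
-- the first part is either 1 or can be lowered by 1.
compositions : ℕ → ℕ → ℕ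
compositions zero    zero    = 1
compositions zero    (suc d) = 0
compositions (suc s) zero    = 0
compositions (suc s) (suc d) = compositions s d + compositions (suc s) d

compositions-suc : ∀ s d → compositions (suc s) d ≡ ∑[ j < d ] compositions s (d ∸ suc (toℕ j))
compositions-suc s zero    = refl
compositions-suc s (suc d) = cong (compositions s d +_) (compositions-suc s d)

compositions+compositions≡C : ∀ s d → compositions s d + compositions (suc s) d ≡ d C s
compositions+compositions≡C zero    zero    = refl
compositions+compositions≡C (suc s) zero    = refl
compositions+compositions≡C zero    (suc d) = compositions+compositions≡C zero d
compositions+compositions≡C (suc s) (suc d) = begin
  compositions s d + compositions (suc s) d + (compositions (suc s) d + compositions (suc (suc s)) d)
    ≡⟨ cong₂ _+_ (compositions+compositions≡C s d) (compositions+compositions≡C (suc s) d) ⟩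
  d C s + d C suc s
    ≡⟨ nCk+nC[k+1]≡[n+1]C[k+1] d s ⟩
  suc d C suc s ∎
  where open ≡-Reasoning

∑-last : ∀ D (f : ℕ → ℕ) → ∑[ s < suc D ] f (toℕ s) ≡ ∑[ s < D ] f (toℕ s) + f D
∑-last zero    f = +-comm (f 0) 0
∑-last (suc D) f = trans (cong (f 0 +_) (∑-last D (f ∘ suc))) (sym (+-assoc (f 0) _ _))

-- Pascal's rule C(k+1,s) = C(k,s) + C(k,s−1), summed against a.
∑-pascal : ∀ D k (a : ℕ → ℕ) → a (suc D) ≡ 0 →
  ∑[ s < suc D ] (a (toℕ s) * (k C toℕ s)) + ∑[ s < suc D ] (a (suc (toℕ s)) * (k C toℕ s))
  ≡ ∑[ s < suc D ] (a (toℕ s) * (suc k C toℕ s))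
∑-pascal D k a a[D+1]≡0 = begin
  ∑[ s < suc D ] (a (toℕ s) * (k C toℕ s)) + ∑[ s < suc D ] (a (suc (toℕ s)) * (k C toℕ s))
    ≡⟨ cong (a 0 * 1 + A +_) (∑-last D (λ s → a (suc s) * (k C s))) ⟩
  a 0 * 1 + A + (B + a (suc D) * (k C D))
    ≡⟨ cong (λ z → a 0 * 1 + A + (B + z * (k C D))) a[D+1]≡0 ⟩
  a 0 * 1 + A + (B + 0)
    ≡⟨ solve 4 (λ x a b z → x :+ a :+ (b :+ z) := x :+ (b :+ a) :+ z) refl (a 0 * 1) A B 0 ⟩
  a 0 * 1 + (B + A) + 0
    ≡⟨ +-identityʳ _ ⟩
  a 0 * 1 + (B + A)
    ≡⟨ cong (a 0 * 1 +_) (∑-distrib-+ {D} (λ s → a (suc (toℕ s)) * (k C toℕ s))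
                                          (λ s → a (suc (toℕ s)) * (k C suc (toℕ s)))) ⟨
  a 0 * 1 + ∑[ s < D ] (a (suc (toℕ s)) * (k C toℕ s) + a (suc (toℕ s)) * (k C suc (toℕ s)))
    ≡⟨ cong (a 0 * 1 +_) (∑-cong D (λ s → trans (sym (*-distribˡ-+ (a (suc (toℕ s))) _ _))
                                                (cong (a (suc (toℕ s)) *_) (nCk+nC[k+1]≡[n+1]C[k+1] k (toℕ s))))) ⟩
  ∑[ s < suc D ] (a (toℕ s) * (suc k C toℕ s)) ∎
  where
  open ≡-Reasoning
  open +-*-Solver
  A B : ℕ
  A = ∑[ s < D ] (a (suc (toℕ s)) * (k C suc (toℕ s)))
  B = ∑[ s < D ] (a (suc (toℕ s)) * (k C toℕ s))

-- Monomials of full support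

∑-truncate : ∀ M d (g : ℕ → ℕ) → d ≤ M →
             ∑[ j < M ] (ind (suc (toℕ j) ≤ᵇ d) * g (toℕ j)) ≡ ∑[ j < d ] g (toℕ j)
∑-truncate M       zero    g _         = sum-replicate-zero M
∑-truncate (suc M) (suc d) g (s≤s d≤M) = cong₂ _+_ (+-identityʳ (g 0)) (∑-truncate M d (g ∘ suc) d≤M)

≤ᵇ-suc : ∀ c d → (c ≤ᵇ d) ≡ (suc c ≤ᵇ suc d)
≤ᵇ-suc zero    d = refl
≤ᵇ-suc (suc c) d = refl

+-≡ᵇ : ∀ c x d → (c + x ≡ᵇ d) ≡ (c ≤ᵇ d) ∧ (x ≡ᵇ d ∸ c)
+-≡ᵇ zero    x d       = refl
+-≡ᵇ (suc c) x zero    = refl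
+-≡ᵇ (suc c) x (suc d) = trans (+-≡ᵇ c x d) (cong (_∧ (x ≡ᵇ d ∸ c)) (≤ᵇ-suc c d))

ind-∧-swap : ∀ a b c → ind a * ind (b ∧ c) ≡ ind b * (ind a * ind c)
ind-∧-swap a true  c = sym (+-identityʳ _)
ind-∧-swap a false c = *-zeroʳ (ind a)

isEmpty : ∀ {n} → Subset n → Bool
isEmpty []      = true
isEmpty (x ∷ σ) = not x ∧ isEmpty σ

isFull : ∀ {n} → Subset n → Bool
isFull []      = true
isFull (x ∷ σ) = x ∧ isFull σ

isWhole : ∀ {n} → Subset n → Bool
isWhole []      = false
isWhole (x ∷ σ) = x ∧ isFull σ

isZero : ∀ {M} → Fin M → Bool
isZero zero    = true
isZero (suc _) = false

nonzero : ∀ {M} → Fin M → Bool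
nonzero c = not (isZero c)

supp-∷ : ∀ {n M} (i : Fin M) (a : Vec (Fin M) n) → supp (i ∷ a) ≡ nonzero i ∷ supp a
supp-∷ zero    a = refl
supp-∷ (suc i) a = refl

fullSupportMonomials : ℕ → ℕ → ℕ → ℕ
fullSupportMonomials s M d = ∑Col s M (λ a → ind (isFull (supp a)) * ind (degree a ≡ᵇ d))

fullSupportMonomials≡compositions : ∀ s M d → d < M → fullSupportMonomials s M d ≡ compositions s d
fullSupportMonomials≡compositions zero    M       zero    _         = refl
fullSupportMonomials≡compositions zero    M       (suc d) _         = refl
fullSupportMonomials≡compositions (suc s) (suc M) d       (s≤s d≤M) = begin
  fullSupportMonomials (suc s) (suc M) d
    ≡⟨ cong (_+ ∑[ j < M ] withFirstExponent j) (∑Vec-zero id s) ⟩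
  ∑[ j < M ] withFirstExponent j
    ≡⟨ ∑-cong M (λ j → firstExponent (suc (toℕ j))) ⟩
  ∑[ j < M ] (ind (suc (toℕ j) ≤ᵇ d) * compositions s (d ∸ suc (toℕ j)))
    ≡⟨ ∑-truncate M d (λ j → compositions s (d ∸ suc j)) d≤M ⟩
  ∑[ j < d ] compositions s (d ∸ suc (toℕ j))
    ≡⟨ compositions-suc s d ⟨
  compositions (suc s) d ∎
  where
  open ≡-Reasoning
  withFirstExponent : Fin M → ℕ
  withFirstExponent j = ∑Col s (suc M) (λ v → ind (isFull (supp v)) * ind (suc (toℕ j) + degree v ≡ᵇ d))
  firstExponent : ∀ c → ∑Col s (suc M) (λ v → ind (isFull (supp v)) * ind (c + degree v ≡ᵇ d))
                    ≡ ind (c ≤ᵇ d) * compositions s (d ∸ c)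
  firstExponent c = begin
    ∑Col s (suc M) (λ v → ind (isFull (supp v)) * ind (c + degree v ≡ᵇ d))
      ≡⟨ ∑Vec-cong id s (λ v → trans (cong (λ b → ind (isFull (supp v)) * ind b) (+-≡ᵇ c (degree v) d))
                                      (ind-∧-swap (isFull (supp v)) (c ≤ᵇ d) _)) ⟩
    ∑Col s (suc M) (λ v → ind (c ≤ᵇ d) * (ind (isFull (supp v)) * ind (degree v ≡ᵇ d ∸ c)))
      ≡⟨ ∑Vec-distribˡ id s (ind (c ≤ᵇ d)) _ ⟩
    ind (c ≤ᵇ d) * fullSupportMonomials s (suc M) (d ∸ c)
      ≡⟨ cong (ind (c ≤ᵇ d) *_) (fullSupportMonomials≡compositions s (suc M) (d ∸ c)
                                                                  (s≤s (≤-trans (m∸n≤m d c) d≤M))) ⟩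
    ind (c ≤ᵇ d) * compositions s (d ∸ c) ∎

-- Disjoint unions of simplices

split : ∀ {A : Set} s {m} → Vec A (s + m) → Vec A s × Vec A m
split zero    v       = [] , v
split (suc s) (x ∷ v) = x ∷ proj₁ (split s v) , proj₂ (split s v)

split-++ : ∀ {A : Set} {s m} (a : Vec A s) (b : Vec A m) → split s (a ++ b) ≡ (a , b)
split-++ []      b = refl
split-++ (x ∷ a) b rewrite split-++ a b = refl

-- The vertex set Fin (sumˡ bs) is cut into consecutive blocks of the sizes listed in bs.
inBlock : (bs : List ℕ) → Subset (sumˡ bs) → Bool
inBlock []       σ = true
inBlock (s ∷ bs) σ = isEmpty σ₂ ∨ (isEmpty σ₁ ∧ inBlock bs σ₂)
  where
  σ₁ : Subset s
  σ₁ = proj₁ (split s σ)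
  σ₂ : Subset (sumˡ bs)
  σ₂ = proj₂ (split s σ)

inBlockBoundary : (bs : List ℕ) → Subset (sumˡ bs) → Bool
inBlockBoundary []       σ = true
inBlockBoundary (s ∷ bs) σ = (isEmpty σ₂ ∧ not (isWhole σ₁)) ∨ (isEmpty σ₁ ∧ inBlockBoundary bs σ₂)
  where
  σ₁ : Subset s
  σ₁ = proj₁ (split s σ)
  σ₂ : Subset (sumˡ bs)
  σ₂ = proj₂ (split s σ)

∈-head : ∀ {n x} {σ : Subset n} → zero ∈ x ∷ σ → T x
∈-head here = _

head-⊆ : ∀ {n x y} {τ σ : Subset n} → x ∷ τ ⊆ y ∷ σ → T x → T y
head-⊆ {x = true} sub _ = ∈-head (sub here)

⊆-∷ : ∀ {n m x y} {τ σ : Subset n} {τ' σ' : Subset m} → x ∷ τ ⊆ y ∷ σ → τ' ⊆ σ' → x ∷ τ' ⊆ y ∷ σ'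
⊆-∷ {x = false} _   sub' = out⊆ sub'
⊆-∷ {x = true} {false} sub _ = ⊥-elim (∈-head (sub here))
⊆-∷ {x = true} {true}  _ sub' = in⊆in sub'

⊆-split : ∀ s {m} {τ σ : Subset (s + m)} → τ ⊆ σ →
          proj₁ (split s τ) ⊆ proj₁ (split s σ) × proj₂ (split s τ) ⊆ proj₂ (split s σ)
⊆-split zero    sub = (λ ()) , sub
⊆-split (suc s) {τ = _ ∷ _} {_ ∷ _} sub =
  let sub₁ , sub₂ = ⊆-split s (drop-∷-⊆ sub) in ⊆-∷ sub sub₁ , sub₂

isEmpty-⊆ : ∀ {n} {τ σ : Subset n} → τ ⊆ σ → T (isEmpty σ) → T (isEmpty τ)
isEmpty-⊆ {τ = []}          {[]}          _   _ = _
isEmpty-⊆ {τ = _ ∷ _}       {true ∷ _}    _   ()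
isEmpty-⊆ {τ = false ∷ _}   {false ∷ _}   sub e = isEmpty-⊆ (drop-∷-⊆ sub) e
isEmpty-⊆ {τ = true ∷ _}    {false ∷ _}   sub _ = ⊥-elim (∈-head (sub here))

isFull-⊆ : ∀ {n} {τ σ : Subset n} → τ ⊆ σ → T (isFull τ) → T (isFull σ)
isFull-⊆ {τ = []}    {[]}    _   _ = _
isFull-⊆ {τ = _ ∷ _} {_ ∷ _} sub h =
  let x , f = T-∧ .to h in T-∧ .from (head-⊆ sub x , isFull-⊆ (drop-∷-⊆ sub) f)

isWhole-⊆ : ∀ {n} {τ σ : Subset n} → τ ⊆ σ → T (isWhole τ) → T (isWhole σ)
isWhole-⊆ {τ = _ ∷ _} {_ ∷ _} = isFull-⊆

inBlock-⊆ : ∀ bs {τ σ} → τ ⊆ σ → T (inBlock bs σ) → T (inBlock bs τ)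
inBlock-⊆ []       _   _ = _
inBlock-⊆ (s ∷ bs) sub h with ⊆-split s sub | T-∨ .to h
... | _    , sub₂ | inj₁ e₂ = T-∨ .from (inj₁ (isEmpty-⊆ sub₂ e₂))
... | sub₁ , sub₂ | inj₂ h′ =
  let e₁ , f = T-∧ .to h′ in T-∨ .from (inj₂ (T-∧ .from (isEmpty-⊆ sub₁ e₁ , inBlock-⊆ bs sub₂ f)))

T-not-antitone : ∀ {a b} → (T a → T b) → T (not b) → T (not a)
T-not-antitone {false} _ _ = _
T-not-antitone {true} {true} _ ()
T-not-antitone {true} {false} a⇒b _ = a⇒b _

inBlockBoundary-⊆ : ∀ bs {τ σ} → τ ⊆ σ → T (inBlockBoundary bs σ) → T (inBlockBoundary bs τ)
inBlockBoundary-⊆ []       _   _ = _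
inBlockBoundary-⊆ (s ∷ bs) sub h with ⊆-split s sub | T-∨ .to h
... | sub₁ , sub₂ | inj₁ h′ =
  let e₂ , nf = T-∧ .to h′ in
  T-∨ .from (inj₁ (T-∧ .from (isEmpty-⊆ sub₂ e₂ , T-not-antitone (isWhole-⊆ sub₁) nf)))
... | sub₁ , sub₂ | inj₂ h′ =
  let e₁ , f = T-∧ .to h′ in T-∨ .from (inj₂ (T-∧ .from (isEmpty-⊆ sub₁ e₁ , inBlockBoundary-⊆ bs sub₂ f)))

inBlockBoundary⇒inBlock : ∀ bs σ → T (inBlockBoundary bs σ) → T (inBlock bs σ)
inBlockBoundary⇒inBlock []       σ _ = _
inBlockBoundary⇒inBlock (s ∷ bs) σ h
  with T-∨ {isEmpty (proj₂ (split s σ)) ∧ not (isWhole (proj₁ (split s σ)))} .to h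
... | inj₁ h′ =
  T-∨ {isEmpty (proj₂ (split s σ))} .from (inj₁ (proj₁ (T-∧ {isEmpty (proj₂ (split s σ))} .to h′)))
... | inj₂ h′ =
  let e₁ , f = T-∧ .to h′ in
  T-∨ {isEmpty (proj₂ (split s σ))} .from (inj₂ (T-∧ .from (e₁ , inBlockBoundary⇒inBlock bs _ f)))

simplices : (bs : List ℕ) → SimplicialComplex (sumˡ bs)
simplices bs = record { face = inBlock bs ; closed = inBlock-⊆ bs }

boundaries : (bs : List ℕ) → SimplicialComplex (sumˡ bs)
boundaries bs = record { face = inBlockBoundary bs ; closed = inBlockBoundary-⊆ bs }

boundaries≤simplices : ∀ bs → boundaries bs ≤SC simplices bs
boundaries≤simplices = inBlockBoundary⇒inBlock

inRel-≟-true : ∀ x y → does ((if x then (if y then false else true) else false) Bool.≟ true) ≡ x ∧ not y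
inRel-≟-true true  true  = refl
inRel-≟-true true  false = refl
inRel-≟-true false y     = refl

hilbertRel≡∑Col : ∀ {N} (Δ Δ' : SimplicialComplex N) k → hilbertRel Δ Δ' k ≡
                  ∑Col N (suc k) (λ u → ind (degree u ≡ᵇ k) * ind (face Δ (supp u) ∧ not (face Δ' (supp u))))
hilbertRel≡∑Col {N} Δ Δ' k = begin
  hilbertRel Δ Δ' k
    ≡⟨ length-filter _ (monomials N k) ⟩
  sumˡ (List.map (λ u → ind (does (inRel Δ Δ' (supp u) Bool.≟ true))) (monomials N k))
    ≡⟨ sum-map-filter _ _ (allVecs N (suc k)) ⟩
  sumˡ (List.map (λ u → ind (degree u ≡ᵇ k) * ind (does (inRel Δ Δ' (supp u) Bool.≟ true))) (allVecs N (suc k)))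
    ≡⟨ sum-map-allVecs N (suc k) _ ⟩
  ∑Col N (suc k) (λ u → ind (degree u ≡ᵇ k) * ind (does (inRel Δ Δ' (supp u) Bool.≟ true)))
    ≡⟨ ∑Vec-cong id N (λ u → cong (λ b → ind (degree u ≡ᵇ k) * ind b)
                                  (inRel-≟-true (face Δ (supp u)) (face Δ' (supp u)))) ⟩
  ∑Col N (suc k) (λ u → ind (degree u ≡ᵇ k) * ind (face Δ (supp u) ∧ not (face Δ' (supp u)))) ∎
  where open ≡-Reasoning

isWholeBlock : (bs : List ℕ) → Subset (sumˡ bs) → Bool
isWholeBlock bs σ = inBlock bs σ ∧ not (inBlockBoundary bs σ)

isEmpty-split : ∀ s {m} (σ : Subset (s + m)) → T (isEmpty σ) →
                T (isEmpty (proj₁ (split s σ))) × T (isEmpty (proj₂ (split s σ)))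
isEmpty-split zero    σ           e = _ , e
isEmpty-split (suc s) (false ∷ σ) e = isEmpty-split s σ e

isEmpty⇒inBlock : ∀ bs σ → T (isEmpty σ) → T (inBlock bs σ)
isEmpty⇒inBlock []       σ _ = _
isEmpty⇒inBlock (s ∷ bs) σ e = T-∨ .from (inj₁ (proj₂ (isEmpty-split s σ e)))

isEmpty⇒inBlockBoundary : ∀ bs σ → T (isEmpty σ) → T (inBlockBoundary bs σ)
isEmpty⇒inBlockBoundary []       σ _ = _
isEmpty⇒inBlockBoundary (s ∷ bs) σ e =
  let e₁ , e₂ = isEmpty-split s σ e in
  T-∨ {isEmpty (proj₂ (split s σ)) ∧ not (isWhole (proj₁ (split s σ)))} .from
    (inj₂ (T-∧ .from (e₁ , isEmpty⇒inBlockBoundary bs (proj₂ (split s σ)) (proj₂ (isEmpty-split s σ e)))))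

isWhole⇒¬isEmpty : ∀ {n} (σ : Subset n) → T (isWhole σ) → T (not (isEmpty σ))
isWhole⇒¬isEmpty (true ∷ σ) _ = _

isWholeBlock-++ : ∀ s bs (σ₁ : Subset s) (σ₂ : Subset (sumˡ bs)) →
  ind (isWholeBlock (s ∷ bs) (σ₁ ++ σ₂))
  ≡ ind (isWhole σ₁) * ind (isEmpty σ₂) + ind (isEmpty σ₁) * ind (isWholeBlock bs σ₂)
isWholeBlock-++ s bs σ₁ σ₂ rewrite split-++ σ₁ σ₂ =
  wholeBlock-cases (isWhole σ₁) (isEmpty σ₁) (isEmpty σ₂) (inBlock bs σ₂) (inBlockBoundary bs σ₂)
    (isWhole⇒¬isEmpty σ₁) (isEmpty⇒inBlock bs σ₂) (isEmpty⇒inBlockBoundary bs σ₂)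
  where
  wholeBlock-cases : ∀ f e₁ e₂ p q → (T f → T (not e₁)) → (T e₂ → T p) → (T e₂ → T q) →
    ind ((e₂ ∨ (e₁ ∧ p)) ∧ not ((e₂ ∧ not f) ∨ (e₁ ∧ q))) ≡ ind f * ind e₂ + ind e₁ * ind (p ∧ not q)
  wholeBlock-cases true  true  true  p q f⇒ _ _ = ⊥-elim (f⇒ _)
  wholeBlock-cases true  false true  p q _ _ _ = refl
  wholeBlock-cases false true  true  p q _ e⇒p e⇒q with p | q | e⇒p _ | e⇒q _
  ... | true | true | _ | _ = refl
  wholeBlock-cases false false true  p q _ _ _ = refl
  wholeBlock-cases f     true  false p q _ _ _ =
    sym (trans (cong (_+ (ind (p ∧ not q) + 0)) (*-zeroʳ (ind f))) (+-identityʳ _))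
  wholeBlock-cases f     false false p q _ _ _ = sym (trans (+-identityʳ _) (*-zeroʳ (ind f)))

supp-++ : ∀ {s m M} (a : Vec (Fin M) s) (b : Vec (Fin M) m) → supp (a ++ b) ≡ supp a ++ supp b
supp-++ []      b = refl
supp-++ (i ∷ a) b = begin
  supp (i ∷ a ++ b)          ≡⟨ supp-∷ i (a ++ b) ⟩
  nonzero i ∷ supp (a ++ b)  ≡⟨ cong (nonzero i ∷_) (supp-++ a b) ⟩
  nonzero i ∷ supp a ++ supp b  ≡⟨ cong (_++ supp b) (supp-∷ i a) ⟨
  supp (i ∷ a) ++ supp b     ∎
  where open ≡-Reasoning

degree-++ : ∀ {s m M} (a : Vec (Fin M) s) (b : Vec (Fin M) m) → degree (a ++ b) ≡ degree a + degree b
degree-++ []      b = refl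
degree-++ (i ∷ a) b = trans (cong (toℕ i +_) (degree-++ a b)) (sym (+-assoc (toℕ i) _ _))

degree-zeros : ∀ m {k} → degree (replicate m (zero {k})) ≡ 0
degree-zeros zero    = refl
degree-zeros (suc m) = degree-zeros m

∑Col-isEmpty : ∀ m k (g : Vec (Fin (suc k)) m → ℕ) →
               ∑Col m (suc k) (λ b → ind (isEmpty (supp b)) * g b) ≡ g (replicate m zero)
∑Col-isEmpty zero    k g = +-identityʳ (g [])
∑Col-isEmpty (suc m) k g = begin
  ∑Col m (suc k) (λ b → ind (isEmpty (supp b)) * g (zero ∷ b)) + ∑[ j < k ] ∑Col m (suc k) (λ _ → 0)
    ≡⟨ cong₂ _+_ (∑Col-isEmpty m k (λ b → g (zero ∷ b))) (∑-cong k (λ _ → ∑Vec-zero id m)) ⟩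
  g (zero ∷ replicate m zero) + ∑[ j < k ] 0
    ≡⟨ cong (g (zero ∷ replicate m zero) +_) (sum-replicate-zero k) ⟩
  g (zero ∷ replicate m zero) + 0
    ≡⟨ +-identityʳ _ ⟩
  g (zero ∷ replicate m zero) ∎
  where open ≡-Reasoning

wholeSupportMonomials : ℕ → ℕ → ℕ
wholeSupportMonomials s k = ∑Col s (suc k) (λ a → ind (isWhole (supp a)) * ind (degree a ≡ᵇ k))

wholeSupportMonomials≡compositions : ∀ s d → wholeSupportMonomials s (suc d) ≡ compositions s (suc d)
wholeSupportMonomials≡compositions zero    d = refl
wholeSupportMonomials≡compositions (suc s) d =
  fullSupportMonomials≡compositions (suc s) (suc (suc d)) (suc d) ≤-refl

blockMonomials : (bs : List ℕ) → ℕ → ℕ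
blockMonomials bs k = ∑Col (sumˡ bs) (suc k) (λ u → ind (degree u ≡ᵇ k) * ind (isWholeBlock bs (supp u)))

blockMonomials-∷ : ∀ s bs k → blockMonomials (s ∷ bs) k ≡ wholeSupportMonomials s k + blockMonomials bs k
blockMonomials-∷ s bs k = begin
  blockMonomials (s ∷ bs) k
    ≡⟨ ∑Vec-++ id s m _ ⟩
  ∑Col s (suc k) (λ a → ∑Col m (suc k) (λ b →
    ind (degree (a ++ b) ≡ᵇ k) * ind (isWholeBlock (s ∷ bs) (supp (a ++ b)))))
    ≡⟨ ∑Vec-cong id s (λ a → ∑Vec-cong id m (split-summand a)) ⟩
  ∑Col s (suc k) (λ a → ∑Col m (suc k) (λ b → ind (isEmpty (supp b)) * P a b + ind (isEmpty (supp a)) * Q a b))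
    ≡⟨ ∑Vec-cong id s (λ a → trans (∑Vec-distrib-+ id m _ _)
                                   (cong₂ _+_ (∑Col-isEmpty m k (P a)) (∑Vec-distribˡ id m (ind (isEmpty (supp a))) (Q a)))) ⟩
  ∑Col s (suc k) (λ a → P a zeros + ind (isEmpty (supp a)) * ∑Col m (suc k) (Q a))
    ≡⟨ ∑Vec-distrib-+ id s _ _ ⟩
  ∑Col s (suc k) (λ a → P a zeros) + ∑Col s (suc k) (λ a → ind (isEmpty (supp a)) * ∑Col m (suc k) (Q a))
    ≡⟨ cong₂ _+_ (∑Vec-cong id s (λ a → cong (λ d → ind (isWhole (supp a)) * ind (d ≡ᵇ k))
                                             (trans (cong (degree a +_) (degree-zeros m)) (+-identityʳ _))))
                 (∑Col-isEmpty s k (λ a → ∑Col m (suc k) (Q a))) ⟩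
  wholeSupportMonomials s k + ∑Col m (suc k) (Q zeros)
    ≡⟨ cong (wholeSupportMonomials s k +_)
            (∑Vec-cong id m (λ b → cong (λ d → ind (d + degree b ≡ᵇ k) * ind (isWholeBlock bs (supp b)))
                                        (degree-zeros s))) ⟩
  wholeSupportMonomials s k + blockMonomials bs k ∎
  where
  open ≡-Reasoning
  open +-*-Solver
  m : ℕ
  m = sumˡ bs
  zeros : ∀ {n} → Vec (Fin (suc k)) n
  zeros = replicate _ zero
  P : Vec (Fin (suc k)) s → Vec (Fin (suc k)) m → ℕ
  P a b = ind (isWhole (supp a)) * ind (degree a + degree b ≡ᵇ k)
  Q : Vec (Fin (suc k)) s → Vec (Fin (suc k)) m → ℕ
  Q a b = ind (degree a + degree b ≡ᵇ k) * ind (isWholeBlock bs (supp b))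
  split-summand : ∀ a b → ind (degree (a ++ b) ≡ᵇ k) * ind (isWholeBlock (s ∷ bs) (supp (a ++ b)))
                          ≡ ind (isEmpty (supp b)) * P a b + ind (isEmpty (supp a)) * Q a b
  split-summand a b rewrite degree-++ a b | supp-++ a b | isWholeBlock-++ s bs (supp a) (supp b) =
    solve 5 (λ e f c a r → e :* (f :* c :+ a :* r) := c :* (f :* e) :+ a :* (e :* r)) refl
      (ind (degree a + degree b ≡ᵇ k)) (ind (isWhole (supp a))) (ind (isEmpty (supp b)))
      (ind (isEmpty (supp a))) (ind (isWholeBlock bs (supp b)))

blockMonomials≡sum : ∀ bs k → blockMonomials bs k ≡ sumˡ (List.map (λ s → wholeSupportMonomials s k) bs)
blockMonomials≡sum []       k = *-zeroʳ (ind (0 ≡ᵇ k))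
blockMonomials≡sum (s ∷ bs) k =
  trans (blockMonomials-∷ s bs k) (cong (wholeSupportMonomials s k +_) (blockMonomials≡sum bs k))

blockSizes : (ℕ → ℕ) → ℕ → List ℕ
blockSizes c D = concatMap (λ s → List.replicate (c s) s List.++ List.replicate (c s) (suc s)) (List.upTo D)

sum-map-replicate-pair : ∀ (g : ℕ → ℕ) r s →
  sumˡ (List.map g (List.replicate r s List.++ List.replicate r (suc s))) ≡ r * (g s + g (suc s))
sum-map-replicate-pair g r s = begin
  sumˡ (List.map g (List.replicate r s List.++ List.replicate r (suc s)))
    ≡⟨ cong sumˡ (map-++ g (List.replicate r s) _) ⟩
  sumˡ (List.map g (List.replicate r s) List.++ List.map g (List.replicate r (suc s)))
    ≡⟨ sum-++ (List.map g (List.replicate r s)) _ ⟩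
  sumˡ (List.map g (List.replicate r s)) + sumˡ (List.map g (List.replicate r (suc s)))
    ≡⟨ cong₂ _+_ (sum-map-replicate g r s) (sum-map-replicate g r (suc s)) ⟩
  r * g s + r * g (suc s)
    ≡⟨ *-distribˡ-+ r (g s) (g (suc s)) ⟨
  r * (g s + g (suc s)) ∎
  where open ≡-Reasoning

sum-map-blockSizes : ∀ (g c : ℕ → ℕ) D →
  sumˡ (List.map g (blockSizes c D)) ≡ ∑[ s < D ] (c (toℕ s) * (g (toℕ s) + g (suc (toℕ s))))
sum-map-blockSizes g c D =
  trans (sum-map-concatMap g _ (List.upTo D))
        (trans (sum-map-applyUpTo _ id D) (∑-cong D (λ s → sum-map-replicate-pair g (c (toℕ s)) (toℕ s))))

hilbertRel-blocks : ∀ (c : ℕ → ℕ) D d →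
  hilbertRel (simplices (blockSizes c D)) (boundaries (blockSizes c D)) (suc d)
  ≡ ∑[ s < D ] (c (toℕ s) * (suc d C toℕ s))
hilbertRel-blocks c D d = begin
  hilbertRel (simplices bs) (boundaries bs) (suc d)
    ≡⟨ hilbertRel≡∑Col (simplices bs) (boundaries bs) (suc d) ⟩
  blockMonomials bs (suc d)
    ≡⟨ blockMonomials≡sum bs (suc d) ⟩
  sumˡ (List.map (λ s → wholeSupportMonomials s (suc d)) bs)
    ≡⟨ cong sumˡ (map-cong (λ s → wholeSupportMonomials≡compositions s d) bs) ⟩
  sumˡ (List.map (λ s → compositions s (suc d)) bs)
    ≡⟨ sum-map-blockSizes _ c D ⟩
  ∑[ s < D ] (c (toℕ s) * (compositions (toℕ s) (suc d) + compositions (suc (toℕ s)) (suc d)))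
    ≡⟨ ∑-cong D (λ s → cong (c (toℕ s) *_) (compositions+compositions≡C (toℕ s) (suc d))) ⟩
  ∑[ s < D ] (c (toℕ s) * (suc d C toℕ s)) ∎
  where
  open ≡-Reasoning
  bs : List ℕ
  bs = blockSizes c D

-- Colourings

does-≡ : ∀ {P : Set} (P? : Dec P) b → (P → T b) → (T b → P) → does P? ≡ b
does-≡ P? true  _   T⇒P = dec-true P? (T⇒P _)
does-≡ P? false P⇒T _   = dec-false P? P⇒T

¬⇒T-not-does : ∀ {P : Set} (P? : Dec P) → ¬ P → T (not (does P?))
¬⇒T-not-does P? ¬p rewrite dec-false P? ¬p = _

T-not-does⇒¬ : ∀ {P : Set} (P? : Dec P) → T (not (does P?)) → ¬ P
T-not-does⇒¬ P? h p rewrite dec-true P? p = h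

allᶠ : ∀ m → (Fin m → Bool) → Bool
allᶠ zero    f = true
allᶠ (suc m) f = f zero ∧ allᶠ m (f ∘ suc)

allᶠ-cong : ∀ m {f g : Fin m → Bool} → (∀ e → f e ≡ g e) → allᶠ m f ≡ allᶠ m g
allᶠ-cong zero    _   = refl
allᶠ-cong (suc m) f≗g = cong₂ _∧_ (f≗g zero) (allᶠ-cong m (f≗g ∘ suc))

∧-interchange : ∀ a b c d → (a ∧ b) ∧ (c ∧ d) ≡ (a ∧ c) ∧ (b ∧ d)
∧-interchange true  b true  d = refl
∧-interchange true  b false d = ∧-zeroʳ b
∧-interchange false b c     d = refl

allᶠ-∧ : ∀ m (f g : Fin m → Bool) → allᶠ m (λ e → f e ∧ g e) ≡ allᶠ m f ∧ allᶠ m g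
allᶠ-∧ zero    f g = refl
allᶠ-∧ (suc m) f g = trans (cong ((f zero ∧ g zero) ∧_) (allᶠ-∧ m (f ∘ suc) (g ∘ suc)))
                           (∧-interchange (f zero) (g zero) (allᶠ m (f ∘ suc)) (allᶠ m (g ∘ suc)))

allᶠ⁻ : ∀ m (f : Fin m → Bool) → T (allᶠ m f) → ∀ e → T (f e)
allᶠ⁻ (suc m) f h zero    = proj₁ (T-∧ .to h)
allᶠ⁻ (suc m) f h (suc e) = allᶠ⁻ m (f ∘ suc) (proj₂ (T-∧ .to h)) e

allᶠ⁺ : ∀ m (f : Fin m → Bool) → (∀ e → T (f e)) → T (allᶠ m f)
allᶠ⁺ zero    f h = _
allᶠ⁺ (suc m) f h = T-∧ .from (h zero , allᶠ⁺ m (f ∘ suc) (h ∘ suc))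

allᶠ-lookup : ∀ {n} (σ : Subset n) → allᶠ n (lookup σ) ≡ isFull σ
allᶠ-lookup []      = refl
allᶠ-lookup (x ∷ σ) = cong (x ∧_) (allᶠ-lookup σ)

disjoint : ∀ {n} → Subset n → Subset n → Bool
disjoint {n} R B = allᶠ n (λ v → not (lookup R v ∧ lookup B v))

disjoint-⊥ : ∀ {n} (R : Subset n) → disjoint R ⊥ ≡ true
disjoint-⊥ []      = refl
disjoint-⊥ (r ∷ R) rewrite ∧-zeroʳ r = disjoint-⊥ R

allᶠ-true : ∀ m → allᶠ m (λ _ → true) ≡ true
allᶠ-true zero    = refl
allᶠ-true (suc m) = allᶠ-true m

uncovered : ∀ {n} → Subset n → ℕ
uncovered []          = 0
uncovered (true ∷ R)  = uncovered R
uncovered (false ∷ R) = suc (uncovered R)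

uncovered≤ : ∀ {n} (R : Subset n) → uncovered R ≤ n
uncovered≤ []          = z≤n
uncovered≤ (true ∷ R)  = m≤n⇒m≤1+n (uncovered≤ R)
uncovered≤ (false ∷ R) = s≤s (uncovered≤ R)

uncovered-∪ : ∀ {n} (R B : Subset n) → uncovered (R ∪ B) ≤ uncovered R
uncovered-∪ []          []          = z≤n
uncovered-∪ (true ∷ R)  (_ ∷ B)     = uncovered-∪ R B
uncovered-∪ (false ∷ R) (true ∷ B)  = m≤n⇒m≤1+n (uncovered-∪ R B)
uncovered-∪ (false ∷ R) (false ∷ B) = s≤s (uncovered-∪ R B)

uncovered-∪-< : ∀ {n} (R B : Subset n) → T (not (isEmpty B)) → T (disjoint R B) → uncovered (R ∪ B) < uncovered R
uncovered-∪-< (true ∷ R)  (true ∷ B)  _  ()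
uncovered-∪-< (true ∷ R)  (false ∷ B) ne d = uncovered-∪-< R B ne d
uncovered-∪-< (false ∷ R) (true ∷ B)  _  _ = s≤s (uncovered-∪ R B)
uncovered-∪-< (false ∷ R) (false ∷ B) ne d = s≤s (uncovered-∪-< R B ne d)

zeroOn : ∀ {n M} → Subset n → Vec (Fin M) n → Bool
zeroOn {n} B x = allᶠ n (λ v → not (lookup B v) ∨ isZero (lookup x v))

-- A colouring with colours 0, …, k+1 arises from its class B of colour 1 and a colouring with colours
-- 0, …, k that vanishes on B: colour 1 is inserted on B and the nonzero colours above it move up.
insertColour : ∀ {k} → Bool → Fin (suc k) → Fin (suc (suc k))
insertColour true  _       = suc zero
insertColour false zero    = zero
insertColour false (suc j) = suc (suc j)

∑Col-byColourClass : ∀ n k (F : Vec (Fin (suc (suc k))) n → ℕ) →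
  ∑Col n (suc (suc k)) F ≡ ∑Sub n (λ B → ∑Col n (suc k) (λ x → ind (zeroOn B x) * F (zipWith insertColour B x)))
∑Col-byColourClass zero    k F = sym (+-identityʳ (F []))
∑Col-byColourClass (suc n) k F = begin
  G zero + (G (suc zero) + ∑[ j < k ] G (suc (suc j)))
    ≡⟨ x∙yz≈y∙xz (G zero) (G (suc zero)) _ ⟩
  G (suc zero) + (G zero + ∑[ j < k ] G (suc (suc j)))
    ≡⟨ cong₂ _+_ trueHalf (trans (+-identityʳ _) falseHalf) ⟨
  ∑Sub (suc n) (λ B → ∑Col (suc n) (suc k) (λ x → ind (zeroOn B x) * F (zipWith insertColour B x))) ∎
  where
  open ≡-Reasoning
  G : Fin (suc (suc k)) → ℕ
  G c = ∑Col n (suc (suc k)) (λ v → F (c ∷ v))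
  lifted : Fin (suc (suc k)) → Subset n → ℕ
  lifted c B = ∑Col n (suc k) (λ v → ind (zeroOn B v) * F (c ∷ zipWith insertColour B v))
  trueHalf : ∑Sub n (λ B → lifted (suc zero) B + ∑[ j < k ] ∑Col n (suc k) (λ _ → 0)) ≡ G (suc zero)
  trueHalf = begin
    ∑Sub n (λ B → lifted (suc zero) B + ∑[ j < k ] ∑Col n (suc k) (λ _ → 0))
      ≡⟨ ∑Vec-cong bool n (λ B → cong (lifted (suc zero) B +_)
                                      (trans (∑-cong k (λ _ → ∑Vec-zero id n)) (sum-replicate-zero k))) ⟩
    ∑Sub n (λ B → lifted (suc zero) B + 0)
      ≡⟨ ∑Vec-cong bool n (λ B → +-identityʳ _) ⟩
    ∑Sub n (lifted (suc zero))
      ≡⟨ ∑Col-byColourClass n k (λ v → F (suc zero ∷ v)) ⟨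
    G (suc zero) ∎
  falseHalf : ∑Sub n (λ B → ∑[ c < suc k ] lifted (insertColour false c) B) ≡ G zero + ∑[ j < k ] G (suc (suc j))
  falseHalf = begin
    ∑Sub n (λ B → ∑[ c < suc k ] lifted (insertColour false c) B)
      ≡⟨ ∑Vec-comm bool n (λ B c → lifted (insertColour false c) B) ⟩
    ∑[ c < suc k ] ∑Sub n (lifted (insertColour false c))
      ≡⟨ ∑-cong (suc k) (λ c → ∑Col-byColourClass n k (λ v → F (insertColour false c ∷ v))) ⟨
    ∑[ c < suc k ] G (insertColour false c) ∎

zeroExactlyOn : ∀ {n M} → Subset n → Vec (Fin M) n → Bool
zeroExactlyOn {n} R x = allᶠ n (λ v → if lookup R v then isZero (lookup x v) else nonzero (lookup x v))

∑Col-zeroExactlyOn-⊥ : ∀ n k (g : Vec (Fin (suc k)) n → ℕ) →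
  ∑Col n (suc k) (λ x → ind (zeroExactlyOn ⊥ x) * g x) ≡ ∑Col n k (λ y → g (Vec.map suc y))
∑Col-zeroExactlyOn-⊥ zero    k g = +-identityʳ (g [])
∑Col-zeroExactlyOn-⊥ (suc n) k g =
  trans (cong (_+ ∑[ j < k ] ∑Col n (suc k) (λ x → ind (zeroExactlyOn ⊥ x) * g (suc j ∷ x))) (∑Vec-zero id n))
        (∑-cong k (λ j → ∑Col-zeroExactlyOn-⊥ n k (λ v → g (suc j ∷ v))))

∑Col-single : ∀ n (f : Vec (Fin 1) n → ℕ) → ∑Col n 1 f ≡ f (replicate n zero)
∑Col-single zero    f = refl
∑Col-single (suc n) f = trans (+-identityʳ _) (∑Col-single n (λ v → f (zero ∷ v)))

zeroExactlyOn-zeros : ∀ {n k} (R : Subset n) → zeroExactlyOn R (replicate n (zero {k})) ≡ isFull R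
zeroExactlyOn-zeros {n} {k} R = trans (allᶠ-cong n atVertex) (allᶠ-lookup R)
  where
  if-true-false : ∀ b → (if b then true else false) ≡ b
  if-true-false true  = refl
  if-true-false false = refl
  atVertex : ∀ v → (if lookup R v then isZero (lookup (replicate n (zero {k})) v)
                                   else nonzero (lookup (replicate n (zero {k})) v))
                   ≡ lookup R v
  atVertex v = trans (cong (λ c → if lookup R v then isZero c else nonzero c) (lookup-replicate v zero))
                     (if-true-false (lookup R v))

isFull⇒lookup : ∀ {n} (R : Subset n) → T (isFull R) → ∀ v → T (lookup R v)
isFull⇒lookup {n} R h = allᶠ⁻ n (lookup R) (subst T (sym (allᶠ-lookup R)) h)

recolourVertex : ∀ {k} b r (c : Fin (suc k)) →
  (not b ∨ isZero c) ∧ (if r then isZero (insertColour b c) else nonzero (insertColour b c))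
  ≡ not (r ∧ b) ∧ (if r ∨ b then isZero c else nonzero c)
recolourVertex true  true  zero    = refl
recolourVertex true  true  (suc c) = refl
recolourVertex true  false zero    = refl
recolourVertex true  false (suc c) = refl
recolourVertex false true  zero    = refl
recolourVertex false true  (suc c) = refl
recolourVertex false false zero    = refl
recolourVertex false false (suc c) = refl

zeroOn-insertColour : ∀ {n k} (R B : Subset n) (x : Vec (Fin (suc k)) n) →
  zeroOn B x ∧ zeroExactlyOn R (zipWith insertColour B x) ≡ disjoint R B ∧ zeroExactlyOn (R ∪ B) x
zeroOn-insertColour {n} {k} R B x = begin
  zeroOn B x ∧ zeroExactlyOn R (zipWith insertColour B x)
    ≡⟨ allᶠ-∧ n _ _ ⟨
  allᶠ n (λ v → (not (lookup B v) ∨ isZero (lookup x v)) ∧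
               (if lookup R v then isZero (lookup y v) else nonzero (lookup y v)))
    ≡⟨ allᶠ-cong n atVertex ⟩
  allᶠ n (λ v → not (lookup R v ∧ lookup B v) ∧
               (if lookup (R ∪ B) v then isZero (lookup x v) else nonzero (lookup x v)))
    ≡⟨ allᶠ-∧ n _ _ ⟩
  disjoint R B ∧ zeroExactlyOn (R ∪ B) x ∎
  where
  open ≡-Reasoning
  y : Vec (Fin (suc (suc k))) n
  y = zipWith insertColour B x
  atVertex : ∀ v → (not (lookup B v) ∨ isZero (lookup x v)) ∧
                   (if lookup R v then isZero (lookup y v) else nonzero (lookup y v))
                   ≡ not (lookup R v ∧ lookup B v) ∧
                     (if lookup (R ∪ B) v then isZero (lookup x v) else nonzero (lookup x v))
  atVertex v rewrite lookup-zipWith insertColour v B x | lookup-zipWith _∨_ v R B =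
    recolourVertex (lookup B v) (lookup R v) (lookup x v)

data VertexStatus {k} : Bool → Bool → Fin (suc k) → Set where
  removed    : VertexStatus true false zero
  recoloured : VertexStatus false true zero
  coloured   : ∀ j → VertexStatus false false (suc j)

vertexStatus : ∀ {k} r b (c : Fin (suc k)) → T (not (r ∧ b)) → T (if r ∨ b then isZero c else nonzero c) →
               VertexStatus r b c
vertexStatus true  false zero    _ _ = removed
vertexStatus false true  zero    _ _ = recoloured
vertexStatus false false (suc j) _ _ = coloured j
vertexStatus true  true  _       () _
vertexStatus true  false (suc _) _ ()
vertexStatus false true  (suc _) _ ()
vertexStatus false false zero    _ ()

recolourEdge : ∀ {k r₁ b₁ r₂ b₂} {c₁ c₂ : Fin (suc k)} → VertexStatus r₁ b₁ c₁ → VertexStatus r₂ b₂ c₂ →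
  (r₁ ∧ r₂) ∨ not (does (insertColour b₁ c₁ FP.≟ insertColour b₂ c₂))
  ≡ not (b₁ ∧ b₂) ∧ (((r₁ ∨ b₁) ∧ (r₂ ∨ b₂)) ∨ not (does (c₁ FP.≟ c₂)))
recolourEdge removed      removed      = refl
recolourEdge removed      recoloured   = refl
recolourEdge removed      (coloured _) = refl
recolourEdge recoloured   removed      = refl
recolourEdge recoloured   recoloured   = refl
recolourEdge recoloured   (coloured _) = refl
recolourEdge (coloured _) removed      = refl
recolourEdge (coloured _) recoloured   = refl
recolourEdge (coloured _) (coloured _) = refl

∑Sub-split-⊥ : ∀ n (g : Subset n → ℕ) → ∑Sub n g ≡ g ⊥ + ∑Sub n (λ B → ind (not (isEmpty B)) * g B)
∑Sub-split-⊥ zero    g = sym (+-identityʳ (g []))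
∑Sub-split-⊥ (suc n) g = begin
  ∑Sub n (λ B → g (true ∷ B)) + (∑Sub n (λ B → g (false ∷ B)) + 0)
    ≡⟨ cong₂ _+_ (∑Vec-cong bool n (λ B → sym (+-identityʳ (g (true ∷ B)))))
                 (cong (_+ 0) (∑Sub-split-⊥ n (λ B → g (false ∷ B)))) ⟩
  A + ((g ⊥ + C) + 0)
    ≡⟨ solve 3 (λ a b c → a :+ ((b :+ c) :+ con 0) := b :+ (a :+ (c :+ con 0))) refl A (g ⊥) C ⟩
  g ⊥ + (A + (C + 0)) ∎
  where
  open ≡-Reasoning
  open +-*-Solver
  A C : ℕ
  A = ∑Sub n (λ B → g (true ∷ B) + 0)
  C = ∑Sub n (λ B → ind (not (isEmpty B)) * g (false ∷ B))

module _ (G : Graph) where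
  open Graph G renaming (nV to n; nE to m)

  properOutside : ∀ {M} → Subset n → Vec (Fin M) n → Bool
  properOutside R x = allᶠ m (λ e → (lookup R (tail e) ∧ lookup R (head e)) ∨
                                     not (does (lookup x (tail e) FP.≟ lookup x (head e))))

  independent : Subset n → Bool
  independent B = allᶠ m (λ e → not (lookup B (tail e) ∧ lookup B (head e)))

  -- The proper k-colourings of G − R, with the extra colour 0 marking the vertices of R.
  colourings : Subset n → ℕ → ℕ
  colourings R k = ∑Col n (suc k) (λ x → ind (zeroExactlyOn R x ∧ properOutside R x))

  chromatic≡colourings : ∀ k → chromatic G k ≡ colourings ⊥ k
  chromatic≡colourings k = begin
    chromatic G k
      ≡⟨ length-filter (proper? G) (allVecs n k) ⟩
    sumˡ (List.map (λ y → ind (does (proper? G y))) (allVecs n k))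
      ≡⟨ sum-map-allVecs n k _ ⟩
    ∑Col n k (λ y → ind (does (proper? G y)))
      ≡⟨ ∑Vec-cong id n (λ y → cong ind (does-≡ (proper? G y) _
                             (λ p → allᶠ⁺ m _ (λ e → ¬⇒T-not-does (lookup y (tail e) FP.≟ lookup y (head e)) (p e)))
                             (λ h e → T-not-does⇒¬ (lookup y (tail e) FP.≟ lookup y (head e)) (allᶠ⁻ m _ h e)))) ⟩
    ∑Col n k (λ y → ind (allᶠ m (λ e → not (does (lookup y (tail e) FP.≟ lookup y (head e))))))
      ≡⟨ ∑Vec-cong id n (λ y → cong ind (allᶠ-cong m (properOutside-⊥ y))) ⟨
    ∑Col n k (λ y → ind (properOutside ⊥ (Vec.map suc y)))
      ≡⟨ ∑Col-zeroExactlyOn-⊥ n k (λ x → ind (properOutside ⊥ x)) ⟨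
    ∑Col n (suc k) (λ x → ind (zeroExactlyOn ⊥ x) * ind (properOutside ⊥ x))
      ≡⟨ ∑Vec-cong id n (λ x → ind-∧ (zeroExactlyOn ⊥ x) (properOutside ⊥ x)) ⟨
    colourings ⊥ k ∎
    where
    open ≡-Reasoning
    properOutside-⊥ : ∀ (y : Vec (Fin k) n) e →
      (lookup ⊥ (tail e) ∧ lookup ⊥ (head e)) ∨
        not (does (lookup (Vec.map suc y) (tail e) FP.≟ lookup (Vec.map suc y) (head e)))
      ≡ not (does (lookup y (tail e) FP.≟ lookup y (head e)))
    properOutside-⊥ y e =
      cong₂ (λ r d → r ∨ not d)
            (cong₂ _∧_ (lookup-replicate (tail e) false) (lookup-replicate (head e) false))
            (cong₂ (λ c c′ → does (c FP.≟ c′)) (lookup-map (tail e) suc y) (lookup-map (head e) suc y))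

  colourings-zero : ∀ R → colourings R 0 ≡ ind (isFull R)
  colourings-zero R = begin
    colourings R 0
      ≡⟨ ∑Col-single n _ ⟩
    ind (zeroExactlyOn R zeros ∧ properOutside R zeros)
      ≡⟨ cong (λ b → ind (b ∧ properOutside R zeros)) (zeroExactlyOn-zeros R) ⟩
    ind (isFull R ∧ properOutside R zeros)
      ≡⟨ cong ind (full⇒proper (isFull R) refl) ⟩
    ind (isFull R) ∎
    where
    open ≡-Reasoning
    zeros : Vec (Fin 1) n
    zeros = replicate n zero
    full⇒proper : ∀ b → isFull R ≡ b → b ∧ properOutside R zeros ≡ b
    full⇒proper false _    = refl
    full⇒proper true  full =
      T-≡ .to (allᶠ⁺ m _ (λ e → T-∨ .from (inj₁ (T-∧ .from (inR (tail e) , inR (head e))))))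
      where inR = isFull⇒lookup R (T-≡ .from full)

  properOutside-insertColour : ∀ {k} (R B : Subset n) (x : Vec (Fin (suc k)) n) →
    T (disjoint R B) → T (zeroExactlyOn (R ∪ B) x) →
    properOutside R (zipWith insertColour B x) ≡ independent B ∧ properOutside (R ∪ B) x
  properOutside-insertColour R B x disj zeros = trans (allᶠ-cong m atEdge) (allᶠ-∧ m _ _)
    where
    status : ∀ v → VertexStatus (lookup R v) (lookup B v) (lookup x v)
    status v = vertexStatus _ _ _ (allᶠ⁻ n _ disj v)
      (subst (λ r → T (if r then isZero (lookup x v) else nonzero (lookup x v)))
             (lookup-zipWith _∨_ v R B) (allᶠ⁻ n _ zeros v))
    atEdge : ∀ e →
      (lookup R (tail e) ∧ lookup R (head e)) ∨
        not (does (lookup (zipWith insertColour B x) (tail e) FP.≟ lookup (zipWith insertColour B x) (head e)))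
      ≡ not (lookup B (tail e) ∧ lookup B (head e)) ∧
        ((lookup (R ∪ B) (tail e) ∧ lookup (R ∪ B) (head e)) ∨
          not (does (lookup x (tail e) FP.≟ lookup x (head e))))
    atEdge e rewrite lookup-zipWith insertColour (tail e) B x | lookup-zipWith insertColour (head e) B x
                   | lookup-zipWith _∨_ (tail e) R B | lookup-zipWith _∨_ (head e) R B =
      recolourEdge (status (tail e)) (status (head e))

  admissible : Subset n → Subset n → ℕ
  admissible R B = ind (disjoint R B ∧ independent B)

  recolour : ∀ {k} (R B : Subset n) (x : Vec (Fin (suc k)) n) →
    ind (zeroOn B x) * ind (zeroExactlyOn R (zipWith insertColour B x) ∧ properOutside R (zipWith insertColour B x))
    ≡ admissible R B * ind (zeroExactlyOn (R ∪ B) x ∧ properOutside (R ∪ B) x)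
  recolour {k} R B x = begin
    ind w * ind (z ∧ p)          ≡⟨ ind-∧ w (z ∧ p) ⟨
    ind (w ∧ (z ∧ p))            ≡⟨ cong ind (∧-assoc w z p) ⟨
    ind ((w ∧ z) ∧ p)            ≡⟨ cong (λ b → ind (b ∧ p)) (zeroOn-insertColour R B x) ⟩
    ind ((d ∧ z′) ∧ p)           ≡⟨ cong ind (regroup d z′ refl refl) ⟩
    ind ((d ∧ i) ∧ (z′ ∧ p′))    ≡⟨ ind-∧ (d ∧ i) (z′ ∧ p′) ⟩
    ind (d ∧ i) * ind (z′ ∧ p′)  ∎
    where
    open ≡-Reasoning
    y : Vec (Fin (suc (suc k))) n
    y  = zipWith insertColour B x
    w z p d i z′ p′ : Bool
    w  = zeroOn B x
    z  = zeroExactlyOn R y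
    p  = properOutside R y
    d  = disjoint R B
    i  = independent B
    z′ = zeroExactlyOn (R ∪ B) x
    p′ = properOutside (R ∪ B) x
    regroup : ∀ a b → d ≡ a → z′ ≡ b → (a ∧ b) ∧ p ≡ (a ∧ i) ∧ (b ∧ p′)
    regroup false b     _  _  = refl
    regroup true  false _  _  = sym (∧-zeroʳ i)
    regroup true  true  d≡ z≡ = properOutside-insertColour R B x (T-≡ .from d≡) (T-≡ .from z≡)

  colourings-suc : ∀ R k →
    colourings R (suc k) ≡ ∑Sub n (λ B → admissible R B * colourings (R ∪ B) k)
  colourings-suc R k =
    trans (∑Col-byColourClass n k _)
          (∑Vec-cong bool n (λ B → trans (∑Vec-cong id n (recolour R B))
                                         (∑Vec-distribˡ id n (admissible R B) _)))

  independent-⊥ : independent ⊥ ≡ true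
  independent-⊥ = trans (allᶠ-cong m (λ e → cong₂ (λ a b → not (a ∧ b)) (lookup-replicate (tail e) false)
                                                                      (lookup-replicate (head e) false)))
                        (allᶠ-true m)

  -- Ordered partitions of the complement of R into s nonempty independent sets.
  orderedPartitions : Subset n → ℕ → ℕ
  orderedPartitions R zero    = ind (isFull R)
  orderedPartitions R (suc s) = ∑Sub n (λ B → ind (not (isEmpty B)) * admissible R B * orderedPartitions (R ∪ B) s)

  orderedPartitions-vanish : ∀ s R → uncovered R < s → orderedPartitions R s ≡ 0
  orderedPartitions-vanish (suc s) R (s≤s u≤s) = trans (∑Vec-cong bool n term) (∑Vec-zero bool n)
    where
    term : ∀ B → ind (not (isEmpty B)) * admissible R B * orderedPartitions (R ∪ B) s ≡ 0
    term B with not (isEmpty B) in ne | disjoint R B in disj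
    ... | false | _     = refl
    ... | true  | false = refl
    ... | true  | true  =
      trans (cong (ind true * ind (true ∧ independent B) *_)
                  (orderedPartitions-vanish s (R ∪ B)
                    (≤-trans (uncovered-∪-< R B (T-≡ .from ne) (T-≡ .from disj)) u≤s)))
            (*-zeroʳ (ind true * ind (true ∧ independent B)))

  partitionSum : Subset n → ℕ → ℕ
  partitionSum R k = ∑[ s < suc n ] (orderedPartitions R (toℕ s) * (k C toℕ s))

  colourings-empty-class : ∀ R k → admissible R ⊥ * colourings (R ∪ ⊥) k ≡ colourings R k
  colourings-empty-class R k =
    trans (cong₂ (λ b S → ind b * colourings S k) (cong₂ _∧_ (disjoint-⊥ R) independent-⊥) (∪-identityʳ R))
          (*-identityˡ _)

  colourings-nonempty-classes : ∀ k → (∀ R → colourings R k ≡ partitionSum R k) → ∀ R →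
    ∑Sub n (λ B → ind (not (isEmpty B)) * (admissible R B * colourings (R ∪ B) k))
    ≡ ∑[ s < suc n ] (orderedPartitions R (suc (toℕ s)) * (k C toℕ s))
  colourings-nonempty-classes k colourings≡ R = begin
    ∑Sub n (λ B → ind (not (isEmpty B)) * (admissible R B * colourings (R ∪ B) k))
      ≡⟨ ∑Vec-cong bool n expand ⟩
    ∑Sub n (λ B → ∑[ s < suc n ] (startingWith B (toℕ s) * (k C toℕ s)))
      ≡⟨ ∑Vec-comm bool n {suc n} (λ B s → startingWith B (toℕ s) * (k C toℕ s)) ⟩
    ∑[ s < suc n ] ∑Sub n (λ B → startingWith B (toℕ s) * (k C toℕ s))
      ≡⟨ ∑-cong (suc n) (λ s → ∑Vec-distribʳ bool n (k C toℕ s) (λ B → startingWith B (toℕ s))) ⟩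
    ∑[ s < suc n ] (orderedPartitions R (suc (toℕ s)) * (k C toℕ s)) ∎
    where
    open ≡-Reasoning
    first : Subset n → ℕ
    first B = ind (not (isEmpty B)) * admissible R B
    startingWith : Subset n → ℕ → ℕ
    startingWith B s = first B * orderedPartitions (R ∪ B) s
    expand : ∀ B → ind (not (isEmpty B)) * (admissible R B * colourings (R ∪ B) k)
                   ≡ ∑[ s < suc n ] (startingWith B (toℕ s) * (k C toℕ s))
    expand B = begin
      ind (not (isEmpty B)) * (admissible R B * colourings (R ∪ B) k)
        ≡⟨ *-assoc (ind (not (isEmpty B))) (admissible R B) _ ⟨
      first B * colourings (R ∪ B) k
        ≡⟨ cong (first B *_) (colourings≡ (R ∪ B)) ⟩
      first B * ∑[ s < suc n ] (orderedPartitions (R ∪ B) (toℕ s) * (k C toℕ s))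
        ≡⟨ *-distribˡ-sum {suc n} (first B) (λ s → orderedPartitions (R ∪ B) (toℕ s) * (k C toℕ s)) ⟩
      ∑[ s < suc n ] (first B * (orderedPartitions (R ∪ B) (toℕ s) * (k C toℕ s)))
        ≡⟨ ∑-cong (suc n) (λ s → *-assoc (first B) (orderedPartitions (R ∪ B) (toℕ s)) (k C toℕ s)) ⟨
      ∑[ s < suc n ] (startingWith B (toℕ s) * (k C toℕ s)) ∎

  colourings≡partitionSum : ∀ k R → colourings R k ≡ partitionSum R k
  colourings≡partitionSum zero R = begin
    colourings R 0                                        ≡⟨ colourings-zero R ⟩
    ind (isFull R)                                        ≡⟨ *-identityʳ _ ⟨
    ind (isFull R) * 1                                    ≡⟨ +-identityʳ _ ⟨
    ind (isFull R) * 1 + 0                                ≡⟨ cong (ind (isFull R) * 1 +_) higherTerms ⟨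
    partitionSum R 0                                      ∎
    where
    open ≡-Reasoning
    higherTerms : ∑[ s < n ] (orderedPartitions R (suc (toℕ s)) * (0 C suc (toℕ s))) ≡ 0
    higherTerms = trans (∑-cong n (λ s → *-zeroʳ (orderedPartitions R (suc (toℕ s))))) (sum-replicate-zero n)
  colourings≡partitionSum (suc k) R = begin
    colourings R (suc k)
      ≡⟨ colourings-suc R k ⟩
    ∑Sub n (λ B → admissible R B * colourings (R ∪ B) k)
      ≡⟨ ∑Sub-split-⊥ n _ ⟩
    admissible R ⊥ * colourings (R ∪ ⊥) k +
    ∑Sub n (λ B → ind (not (isEmpty B)) * (admissible R B * colourings (R ∪ B) k))
      ≡⟨ cong₂ _+_ (trans (colourings-empty-class R k) (colourings≡partitionSum k R))
                   (colourings-nonempty-classes k (colourings≡partitionSum k) R) ⟩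
    partitionSum R k + ∑[ s < suc n ] (orderedPartitions R (suc (toℕ s)) * (k C toℕ s))
      ≡⟨ ∑-pascal n k (orderedPartitions R) (orderedPartitions-vanish (suc n) R (s≤s (uncovered≤ R))) ⟩
    partitionSum R (suc k) ∎
    where open ≡-Reasoning

theorem11 : (G : Graph) →
    Σ ℕ (λ N → Σ (SimplicialComplex N) (λ Δ → Σ (SimplicialComplex N) (λ Δ' →
      (Δ' ≤SC Δ) × ((k : ℕ) → chromatic G (suc k) ≡ hilbertRel Δ Δ' (suc k)))))
theorem11 G = sumˡ bs , simplices bs , boundaries bs , boundaries≤simplices bs , chromatic≡hilbertRel
  where
  n : ℕ
  n = Graph.nV G
  c : ℕ → ℕ
  c = orderedPartitions G ⊥
  bs : List ℕ
  bs = blockSizes c (suc n)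
  chromatic≡hilbertRel : ∀ k → chromatic G (suc k) ≡ hilbertRel (simplices bs) (boundaries bs) (suc k)
  chromatic≡hilbertRel k = begin
    chromatic G (suc k)                                ≡⟨ chromatic≡colourings G (suc k) ⟩
    colourings G ⊥ (suc k)                             ≡⟨ colourings≡partitionSum G (suc k) ⊥ ⟩
    ∑[ s < suc n ] (c (toℕ s) * (suc k C toℕ s))       ≡⟨ hilbertRel-blocks c (suc n) k ⟨
    hilbertRel (simplices bs) (boundaries bs) (suc k)  ∎
    where open ≡-Reasoning
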